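{- Let $A\in\mathbb{C}$ with $A(A^2+4)\ne0$. For any positive even integer $n$, $$A^2\det[x\delta_{jk}-u_{j+k}(A,-1)]_{0\le j,k\le n-1}=A^2x^n-A\,u_n(A,-1)v_{n-1}(A,-1)\,x^{n-1}-u_n(A,-1)^2x^{n-2},$$ where $\delta_{jk}$ is $1$ if $j=k$ and $0$ otherwise.
   Context: For $a,b\in\mathbb{C}$, the Lucas sequences are defined by $u_0(a,b)=0$, $u_1(a,b)=1$, $v_0(a,b)=2$, $v_1(a,b)=a$, and $u_{m+1}(a,b)=au_m(a,b)-bu_{m-1}(a,b)$, $v_{m+1}(a,b)=av_m(a,b)-bv_{m-1}(a,b)$ for $m\ge1$. The convention $0^0=1$ is used. -}

module Defs where

open import Level using (Level)
open import Algebra.Bundles using (CommutativeRing)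
open import Data.Nat using (ℕ; zero; suc)
open import Data.Fin using (Fin; zero; suc; punchIn; _≟_)
open import Relation.Nullary using (yes; no)

-- Definitions over an arbitrary commutative ring R (the paper works in ℂ).
module RingDefs {c ℓ : Level} (R : CommutativeRing c ℓ) where
  open CommutativeRing R hiding (zero)

  u : Carrier → Carrier → ℕ → Carrier
  u a b zero = 0#
  u a b (suc zero) = 1#
  u a b (suc (suc m)) = a * u a b (suc m) - b * u a b m

  v : Carrier → Carrier → ℕ → Carrier
  v a b zero = 1# + 1#
  v a b (suc zero) = a
  v a b (suc (suc m)) = a * v a b (suc m) - b * v a b m

  -- powers, with x ^ 0 = 1 (so 0^0 = 1)
  _^_ : Carrier → ℕ → Carrier
  x ^ zero = 1#
  x ^ suc n = x * (x ^ n)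

  δ : ∀ {n} → Fin n → Fin n → Carrier
  δ j k with j ≟ k
  ... | yes _ = 1#
  ... | no _ = 0#

  sumFin : ∀ n → (Fin n → Carrier) → Carrier
  sumFin zero f = 0#
  sumFin (suc n) f = f zero + sumFin n (λ i → f (suc i))

  sign : ∀ {n} → Fin n → Carrier
  sign zero = 1#
  sign (suc j) = - sign j

  minor : ∀ {n} → (Fin (suc n) → Fin (suc n) → Carrier) → Fin (suc n) → Fin n → Fin n → Carrier
  minor M j r c = M (suc r) (punchIn j c)

  det : ∀ n → (Fin n → Fin n → Carrier) → Carrier
  det zero M = 1#
  det (suc n) M = sumFin (suc n) (λ j → sign j * (M zero j * det n (minor M j)))

-- Since u_{j+k} = u_{j+1} u_k + u_j u_{k-1} (with u_{-1} = 1), the Hankel matrix H = [u_{j+k}] is the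
-- rank-two matrix a bᵀ + c dᵀ with a_j = u_{j+1}, b_k = u_k, c_j = u_j, d_k = u_{k-1}, and for such H
--   det (x I - H) = xⁿ - xⁿ⁻¹ (a·b + c·d) + xⁿ⁻² ((a·b)(c·d) - (a·d)(c·b)).
-- This comes from the rank-one update det (M + c wᵀ) = det M + Σᵣ cᵣ det (M with row r replaced by w),
-- a consequence of multilinearity and the alternating property of the Laplace expansion. The inner
-- products telescope: A Σ u_j² = u_n u_{n-1}, and for even n also A Σ u_{j+1} u_j = u_n² and
-- Σ u_{j+1} u_{j-1} = Σ u_j²; Cassini's identity u_n² - A u_n u_{n-1} - u_{n-1}² = -1 (n even) then
-- turns A² times the two coefficients into A u_n v_{n-1} and -u_n².

module Submission where

open import Defs
open import Level using (Level; _⊔_)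
open import Algebra.Bundles using (CommutativeRing)
open import Data.Nat as ℕ using (ℕ; zero; suc; _<_; _∸_)
import Data.Nat.Properties as ℕ
open import Data.Nat.Divisibility using (_∣_; divides)
open import Data.Integer as ℤ using (ℤ; +_; -[1+_]; _⊖_)
import Data.Integer.Properties as ℤ
open import Data.Fin as Fin using (Fin; zero; suc; toℕ; punchIn; lift)
open import Data.Fin.Properties using (suc-injective; punchInᵢ≢i)
open import Data.Vec.Functional using (updateAt)
open import Data.Vec.Functional.Properties using (updateAt-updates; updateAt-minimal; updateAt-id-local; map-updateAt-local)
open import Data.Maybe using (Maybe; just; nothing)
open import Data.Empty using (⊥-elim)
open import Function using (_∘_; const)
open import Relation.Nullary using (¬_; yes; no)
open import Relation.Binary.PropositionalEquality as ≡ using (_≡_; _≢_)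
open import Algebra.Solver.Ring.AlmostCommutativeRing
  using (fromCommutativeRing; _-Raw-AlmostCommutative⟶_)

-- Algebra.Solver.Ring needs coefficients with decidable equality; ℤ maps into every commutative ring.
module ℤ-CoefficientSolver {c ℓ : Level} (R : CommutativeRing c ℓ) where
  open CommutativeRing R hiding (zero)
  open import Algebra.Properties.Semiring.Mult.TCOptimised semiring using (_×_; 1+×; ×-homo-+; ×1-homo-*)
  open import Algebra.Properties.Ring ring using (-‿involutive; -‿distribˡ-*; -‿+-comm; -0#≈0#)
  open import Algebra.Solver.CommutativeMonoid +-commutativeMonoid using (solve; _⊕_; _⊜_)
  open import Relation.Binary.Reasoning.Setoid setoid

  ⟦_⟧ℤ : ℤ → Carrier
  ⟦ + n ⟧ℤ = n × 1#
  ⟦ -[1+ n ] ⟧ℤ = - (suc n × 1#)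

  ⊖-homo : ∀ m n → ⟦ m ⊖ n ⟧ℤ ≈ m × 1# - n × 1#
  ⊖-homo m zero rewrite ℤ.⊖-≥ (ℕ.z≤n {m}) = sym (trans (+-congˡ -0#≈0#) (+-identityʳ _))
  ⊖-homo zero (suc n) rewrite ℤ.⊖-< (ℕ.s≤s (ℕ.z≤n {n})) = sym (+-identityˡ _)
  ⊖-homo (suc m) (suc n) rewrite ℤ.[1+m]⊖[1+n]≡m⊖n m n = begin
    ⟦ m ⊖ n ⟧ℤ                          ≈⟨ ⊖-homo m n ⟩
    m × 1# - n × 1#                     ≈⟨ +-identityˡ _ ⟨
    0# + (m × 1# - n × 1#)              ≈⟨ +-congʳ (-‿inverseʳ 1#) ⟨
    (1# - 1#) + (m × 1# - n × 1#)       ≈⟨ solve 4 (λ a a⁻ b b⁻ → (a ⊕ a⁻) ⊕ (b ⊕ b⁻) ⊜ (a ⊕ b) ⊕ (a⁻ ⊕ b⁻))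
                                                     refl 1# (- 1#) (m × 1#) (- (n × 1#)) ⟩
    (1# + m × 1#) + (- 1# - n × 1#)     ≈⟨ +-congˡ (-‿+-comm 1# (n × 1#)) ⟩
    (1# + m × 1#) - (1# + n × 1#)       ≈⟨ +-cong (1+× m 1#) (-‿cong (1+× n 1#)) ⟨
    suc m × 1# - suc n × 1#             ∎

  -‿homo : ∀ i → ⟦ ℤ.- i ⟧ℤ ≈ - ⟦ i ⟧ℤ
  -‿homo (+ zero) = sym -0#≈0#
  -‿homo (+ suc n) = refl
  -‿homo -[1+ n ] = sym (-‿involutive _)

  +-homo : ∀ i j → ⟦ i ℤ.+ j ⟧ℤ ≈ ⟦ i ⟧ℤ + ⟦ j ⟧ℤ
  +-homo (+ m) (+ n) = ×-homo-+ 1# m n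
  +-homo (+ m) -[1+ n ] = ⊖-homo m (suc n)
  +-homo -[1+ m ] (+ n) = trans (⊖-homo n (suc m)) (+-comm _ _)
  +-homo -[1+ m ] -[1+ n ] = begin
    - (suc (suc m ℕ.+ n) × 1#)           ≡⟨ ≡.cong (λ k → - (suc k × 1#)) (ℕ.+-suc m n) ⟨
    - ((suc m ℕ.+ suc n) × 1#)           ≈⟨ -‿cong (×-homo-+ 1# (suc m) (suc n)) ⟩
    - (suc m × 1# + suc n × 1#)          ≈⟨ -‿+-comm _ _ ⟨
    - (suc m × 1#) - suc n × 1#          ∎

  *-homo-+ : ∀ n j → ⟦ + n ℤ.* j ⟧ℤ ≈ n × 1# * ⟦ j ⟧ℤ
  *-homo-+ zero j = sym (zeroˡ _)
  *-homo-+ (suc n) j = begin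
    ⟦ + suc n ℤ.* j ⟧ℤ                  ≡⟨ ≡.cong ⟦_⟧ℤ (ℤ.suc-* (+ n) j) ⟩
    ⟦ j ℤ.+ + n ℤ.* j ⟧ℤ                ≈⟨ +-homo j (+ n ℤ.* j) ⟩
    ⟦ j ⟧ℤ + ⟦ + n ℤ.* j ⟧ℤ             ≈⟨ +-cong (sym (*-identityˡ _)) (*-homo-+ n j) ⟩
    1# * ⟦ j ⟧ℤ + n × 1# * ⟦ j ⟧ℤ       ≈⟨ distribʳ _ _ _ ⟨
    (1# + n × 1#) * ⟦ j ⟧ℤ              ≈⟨ *-congʳ (1+× n 1#) ⟨
    suc n × 1# * ⟦ j ⟧ℤ                 ∎

  *-homo : ∀ i j → ⟦ i ℤ.* j ⟧ℤ ≈ ⟦ i ⟧ℤ * ⟦ j ⟧ℤ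
  *-homo (+ n) j = *-homo-+ n j
  *-homo -[1+ n ] j = begin
    ⟦ -[1+ n ] ℤ.* j ⟧ℤ                 ≡⟨ ≡.cong ⟦_⟧ℤ (ℤ.neg-distribˡ-* (+ suc n) j) ⟨
    ⟦ ℤ.- (+ suc n ℤ.* j) ⟧ℤ            ≈⟨ -‿homo (+ suc n ℤ.* j) ⟩
    - ⟦ + suc n ℤ.* j ⟧ℤ                ≈⟨ -‿cong (*-homo-+ (suc n) j) ⟩
    - (suc n × 1# * ⟦ j ⟧ℤ)             ≈⟨ -‿distribˡ-* _ _ ⟩
    - (suc n × 1#) * ⟦ j ⟧ℤ             ∎

  ℤ-homomorphism : CommutativeRing.rawRing ℤ.+-*-commutativeRing -Raw-AlmostCommutative⟶ fromCommutativeRing R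
  ℤ-homomorphism = record
    { ⟦_⟧ = ⟦_⟧ℤ ; +-homo = +-homo ; *-homo = *-homo ; -‿homo = -‿homo
    ; 0-homo = refl ; 1-homo = refl }

  ℤ-test : ∀ i j → Maybe (⟦ i ⟧ℤ ≈ ⟦ j ⟧ℤ)
  ℤ-test i j with i ℤ.≟ j
  ... | yes ≡.refl = just refl
  ... | no _ = nothing

  open import Algebra.Solver.Ring (CommutativeRing.rawRing ℤ.+-*-commutativeRing) (fromCommutativeRing R) ℤ-homomorphism ℤ-test public

module FinSum {c ℓ : Level} (R : CommutativeRing c ℓ) where
  open CommutativeRing R hiding (zero)
  open RingDefs R
  open ℤ-CoefficientSolver R using (solve; _:=_; _:+_; _:*_; _:-_; con)
  open import Algebra.Properties.Semiring.Sum semiring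
  open import Algebra.Properties.Ring ring using (-1*x≈-x)
  open import Relation.Binary.Reasoning.Setoid setoid

  sumFin≡sum : ∀ n (f : Fin n → Carrier) → sumFin n f ≡ sum f
  sumFin≡sum zero f = ≡.refl
  sumFin≡sum (suc n) f = ≡.cong (λ s → f zero + s) (sumFin≡sum n (f ∘ suc))

  sumFin-cong : ∀ n {f g : Fin n → Carrier} → (∀ i → f i ≈ g i) → sumFin n f ≈ sumFin n g
  sumFin-cong n {f} {g} f≈g = begin
    sumFin n f ≡⟨ sumFin≡sum n f ⟩
    sum f      ≈⟨ sum-cong-≋ f≈g ⟩
    sum g      ≡⟨ sumFin≡sum n g ⟨
    sumFin n g ∎

  sumFin-zero : ∀ n {f : Fin n → Carrier} → (∀ i → f i ≈ 0#) → sumFin n f ≈ 0#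
  sumFin-zero n f≈0 = trans (sumFin-cong n f≈0) (trans (reflexive (sumFin≡sum n _)) (sum-replicate-zero n))

  sumFin-+ : ∀ n (f g : Fin n → Carrier) → sumFin n (λ i → f i + g i) ≈ sumFin n f + sumFin n g
  sumFin-+ n f g = begin
    sumFin n (λ i → f i + g i) ≡⟨ sumFin≡sum n _ ⟩
    sum (λ i → f i + g i)      ≈⟨ ∑-distrib-+ f g ⟩
    sum f + sum g              ≡⟨ ≡.cong₂ _+_ (sumFin≡sum n f) (sumFin≡sum n g) ⟨
    sumFin n f + sumFin n g    ∎

  *-distribˡ-sumFin : ∀ n a (f : Fin n → Carrier) → a * sumFin n f ≈ sumFin n (λ i → a * f i)
  *-distribˡ-sumFin n a f = begin
    a * sumFin n f              ≡⟨ ≡.cong (a *_) (sumFin≡sum n f) ⟩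
    a * sum f                   ≈⟨ *-distribˡ-sum a f ⟩
    sum (λ i → a * f i)         ≡⟨ sumFin≡sum n _ ⟨
    sumFin n (λ i → a * f i)    ∎

  -‿distrib-sumFin : ∀ n (f : Fin n → Carrier) → - sumFin n f ≈ sumFin n (λ i → - f i)
  -‿distrib-sumFin n f = begin
    - sumFin n f                  ≈⟨ -1*x≈-x _ ⟨
    - 1# * sumFin n f             ≈⟨ *-distribˡ-sumFin n (- 1#) f ⟩
    sumFin n (λ i → - 1# * f i)   ≈⟨ sumFin-cong n (λ i → -1*x≈-x (f i)) ⟩
    sumFin n (λ i → - f i)        ∎

  sumFin-comm : ∀ m n (f : Fin m → Fin n → Carrier) →
    sumFin m (λ i → sumFin n (f i)) ≈ sumFin n (λ j → sumFin m (λ i → f i j))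
  sumFin-comm m n f = begin
    sumFin m (λ i → sumFin n (f i))       ≈⟨ sumFin-cong m (λ i → reflexive (sumFin≡sum n (f i))) ⟩
    sumFin m (λ i → sum (f i))            ≡⟨ sumFin≡sum m _ ⟩
    sum (λ i → sum (f i))                 ≈⟨ ∑-comm f ⟩
    sum (λ j → sum (λ i → f i j))         ≡⟨ sumFin≡sum n _ ⟨
    sumFin n (λ j → sum (λ i → f i j))    ≈⟨ sumFin-cong n (λ j → reflexive (sumFin≡sum m _)) ⟨
    sumFin n (λ j → sumFin m (λ i → f i j)) ∎

  sumFin-single : ∀ n (f : Fin n → Carrier) i → (∀ j → j ≢ i → f j ≈ 0#) → sumFin n f ≈ f i
  sumFin-single (suc n) f zero others =
    trans (+-congˡ (sumFin-zero n (λ j → others (suc j) λ ()))) (+-identityʳ _)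
  sumFin-single (suc n) f (suc i) others =
    trans (+-cong (others zero λ ()) (sumFin-single n (f ∘ suc) i (λ j j≢i → others (suc j) (j≢i ∘ suc-injective))))
          (+-identityˡ _)

  sumFin-+-* : ∀ n (f g : Fin n → Carrier) a → sumFin n (λ i → f i + a * g i) ≈ sumFin n f + a * sumFin n g
  sumFin-+-* n f g a = trans (sumFin-+ n f (λ i → a * g i)) (+-congˡ (sym (*-distribˡ-sumFin n a g)))

  sumUpTo : ℕ → (ℕ → Carrier) → Carrier
  sumUpTo n f = sumFin n (λ j → f (toℕ j))

  sumUpTo-suc : ∀ n f → sumUpTo (suc n) f ≈ sumUpTo n f + f n
  sumUpTo-suc zero f = trans (+-identityʳ _) (sym (+-identityˡ _))
  sumUpTo-suc (suc n) f = trans (+-congˡ (sumUpTo-suc n (f ∘ suc))) (sym (+-assoc _ _ _))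

  sumFin-linear : ∀ n y P Q (f g : Fin n → Carrier) →
    sumFin n (λ s → y * (f s * P - g s * Q)) ≈ y * (sumFin n f * P - sumFin n g * Q)
  sumFin-linear zero y P Q f g = solve 3 (λ y P Q → con (+ 0) := y :* (con (+ 0) :* P :- con (+ 0) :* Q)) refl y P Q
  sumFin-linear (suc n) y P Q f g = trans (+-congˡ (sumFin-linear n y P Q (f ∘ suc) g′))
    (solve 7 (λ y P Q a b A B → y :* (a :* P :- b :* Q) :+ y :* (A :* P :- B :* Q) := y :* ((a :+ A) :* P :- (b :+ B) :* Q))
           refl y P Q (f zero) (g zero) (sumFin n (f ∘ suc)) (sumFin n g′))
    where g′ = λ i → g (suc i)

module Determinant {c ℓ : Level} (R : CommutativeRing c ℓ) where
  open CommutativeRing R hiding (zero)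
  open RingDefs R
  open FinSum R
  open ℤ-CoefficientSolver R using (solve; _:=_; _:+_; _:*_; :-_; _:-_; con)
  open import Algebra.Properties.Ring ring using (-‿distribˡ-*; -‿involutive; -0#≈0#)
  open import Algebra.Properties.Group +-group using (inverseʳ-unique)
  open import Algebra.Properties.CommutativeSemigroup *-commutativeSemigroup using (x∙yz≈y∙xz)
  open import Relation.Binary.Reasoning.Setoid setoid

  Row : ℕ → Set c
  Row n = Fin n → Carrier

  Matrix : ℕ → Set c
  Matrix n = Fin n → Row n

  infixl 5 _[_]≔_
  _[_]≔_ : ∀ {m n} → (Fin m → Row n) → Fin m → Row n → Fin m → Row n
  M [ i ]≔ w = updateAt M i (const w)

  ≔-columns : ∀ {m n p} (M : Fin m → Row n) i w (σ : Fin p → Fin n) r k →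
    (M [ i ]≔ w) r (σ k) ≡ ((λ r → M r ∘ σ) [ i ]≔ w ∘ σ) r k
  ≔-columns M i w σ r k = ≡.cong (λ row → row k) (map-updateAt-local {f = _∘ σ} M i ≡.refl r)

  ≔-cong : ∀ {m n} {M N : Fin m → Row n} i w → (∀ r k → M r k ≈ N r k) → ∀ r k → (M [ i ]≔ w) r k ≈ (N [ i ]≔ w) r k
  ≔-cong zero w M≈N zero k = refl
  ≔-cong zero w M≈N (suc r) k = M≈N (suc r) k
  ≔-cong (suc i) w M≈N zero k = M≈N zero k
  ≔-cong (suc i) w M≈N (suc r) k = ≔-cong i w (M≈N ∘ suc) r k

  ≔-rank-one : ∀ {m n} (M : Fin m → Row n) (a : Row m) (b d : Row n) r s k →
    ((λ s k → M s k + a s * b k) [ r ]≔ d) s k ≈ (M [ r ]≔ d) s k + updateAt a r (const 0#) s * b k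
  ≔-rank-one M a b d zero zero k = solve 2 (λ d b → d := d :+ con (+ 0) :* b) refl (d k) (b k)
  ≔-rank-one M a b d zero (suc s) k = refl
  ≔-rank-one M a b d (suc r) zero k = refl
  ≔-rank-one M a b d (suc r) (suc s) k = ≔-rank-one (M ∘ suc) (a ∘ suc) b d r s k

  det-cong : ∀ n {M N : Matrix n} → (∀ r k → M r k ≈ N r k) → det n M ≈ det n N
  det-cong zero M≈N = refl
  det-cong (suc n) M≈N = sumFin-cong (suc n) λ j →
    *-congˡ {sign j} (*-cong (M≈N zero j) (det-cong n (λ r k → M≈N (suc r) (punchIn j k))))

  det-minor-≔ : ∀ n (M : Matrix (suc n)) i w j →
    det n (minor (M [ suc i ]≔ w) j) ≈ det n (minor M j [ i ]≔ w ∘ punchIn j)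
  det-minor-≔ n M i w j = det-cong n λ r k → reflexive (≔-columns (M ∘ suc) i w (punchIn j) r k)

  det-+-row : ∀ n (M : Matrix n) i (p q : Row n) →
    det n (M [ i ]≔ (λ k → p k + q k)) ≈ det n (M [ i ]≔ p) + det n (M [ i ]≔ q)
  det-+-row (suc n) M zero p q = trans
    (sumFin-cong (suc n) λ j → solve 4 (λ s a b d → s :* ((a :+ b) :* d) := s :* (a :* d) :+ s :* (b :* d)) refl
      (sign j) (p j) (q j) (det n (minor M j)))
    (sumFin-+ (suc n) (λ j → sign j * (p j * det n (minor M j))) (λ j → sign j * (q j * det n (minor M j))))
  det-+-row (suc n) M (suc i) p q = trans (sumFin-cong (suc n) expand) (sumFin-+ (suc n) (term p) (term q))
    where
    term : Row (suc n) → Fin (suc n) → Carrier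
    term w j = sign j * (M zero j * det n (minor (M [ suc i ]≔ w) j))
    expand : ∀ j → term (λ k → p k + q k) j ≈ term p j + term q j
    expand j = begin
      sign j * (M zero j * det n (minor (M [ suc i ]≔ (λ k → p k + q k)) j))
        ≈⟨ *-congˡ (*-congˡ (det-minor-≔ n M i _ j)) ⟩
      sign j * (M zero j * det n (minor M j [ i ]≔ (λ k → p (punchIn j k) + q (punchIn j k))))
        ≈⟨ *-congˡ (*-congˡ (det-+-row n (minor M j) i _ _)) ⟩
      sign j * (M zero j * (det n (minor M j [ i ]≔ p ∘ punchIn j) + det n (minor M j [ i ]≔ q ∘ punchIn j)))
        ≈⟨ solve 4 (λ s a d e → s :* (a :* (d :+ e)) := s :* (a :* d) :+ s :* (a :* e)) refl (sign j) (M zero j) _ _ ⟩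
      sign j * (M zero j * det n (minor M j [ i ]≔ p ∘ punchIn j)) + sign j * (M zero j * det n (minor M j [ i ]≔ q ∘ punchIn j))
        ≈⟨ +-cong (*-congˡ (*-congˡ (det-minor-≔ n M i p j))) (*-congˡ (*-congˡ (det-minor-≔ n M i q j))) ⟨
      term p j + term q j ∎

  det-zero-row : ∀ n (M : Matrix n) i → (∀ k → M i k ≈ 0#) → det n M ≈ 0#
  det-zero-row (suc n) M zero Mᵢ≈0 = sumFin-zero (suc n) λ j →
    trans (*-congˡ {sign j} (trans (*-congʳ (Mᵢ≈0 j)) (zeroˡ (det n (minor M j))))) (zeroʳ _)
  det-zero-row (suc n) M (suc i) Mᵢ≈0 = sumFin-zero (suc n) λ j →
    trans (*-congˡ {sign j} (trans (*-congˡ {M zero j} (det-zero-row n (minor M j) i (Mᵢ≈0 ∘ punchIn j))) (zeroʳ _))) (zeroʳ _)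

  Respects≗ : ∀ {n m} → ((Fin n → Fin m) → Carrier) → Set ℓ
  Respects≗ D = ∀ {σ τ} → (∀ k → σ k ≡ τ k) → D σ ≈ D τ

  -- Laplace expansion along the first two rows, D σ being the minor on the remaining rows and the columns σ;
  -- det (2 + n) M unfolds to it definitionally.
  pairExpansion : ∀ n → Row (2 ℕ.+ n) → Row (2 ℕ.+ n) → ((Fin n → Fin (2 ℕ.+ n)) → Carrier) → Carrier
  pairExpansion n a b D = sumFin (2 ℕ.+ n) λ j →
    sign j * (a j * sumFin (suc n) λ l → sign l * (b (punchIn j l) * D (punchIn j ∘ punchIn l)))

  pairExpansion-split : ∀ n a b D → Respects≗ D →
    pairExpansion (suc n) a b D
      ≈ sumFin (2 ℕ.+ n) (λ l → a zero * (sign l * (b (suc l) * D (suc ∘ punchIn l)))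
                               - sign l * (a (suc l) * (b zero * D (suc ∘ punchIn l))))
        + pairExpansion n (a ∘ suc) (b ∘ suc) (D ∘ lift 1)
  pairExpansion-split n a b D D-resp = begin
    1# * (a zero * sumFin (2 ℕ.+ n) (λ l → sign l * (b (suc l) * F l))) + sumFin (2 ℕ.+ n) Z
      ≈⟨ +-cong (trans (*-identityˡ _) (*-distribˡ-sumFin (2 ℕ.+ n) (a zero) (λ l → sign l * (b (suc l) * F l))))
                (sumFin-cong (2 ℕ.+ n) Z≈X+Y) ⟩
    sumFin (2 ℕ.+ n) P + sumFin (2 ℕ.+ n) (λ j → X j + Y j)
      ≈⟨ +-congˡ (sumFin-+ (2 ℕ.+ n) X Y) ⟩
    sumFin (2 ℕ.+ n) P + (sumFin (2 ℕ.+ n) X + sumFin (2 ℕ.+ n) Y)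
      ≈⟨ +-assoc _ _ _ ⟨
    (sumFin (2 ℕ.+ n) P + sumFin (2 ℕ.+ n) X) + sumFin (2 ℕ.+ n) Y
      ≈⟨ +-congʳ (sumFin-+ (2 ℕ.+ n) P X) ⟨
    sumFin (2 ℕ.+ n) (λ l → P l + X l) + pairExpansion n (a ∘ suc) (b ∘ suc) (D ∘ lift 1) ∎
    where
    F : Fin (2 ℕ.+ n) → Carrier
    F l = D (suc ∘ punchIn l)
    G : Fin (2 ℕ.+ n) → Fin (suc n) → Carrier
    G j l = b (suc (punchIn j l)) * D (lift 1 (punchIn j ∘ punchIn l))
    P X Y Z : Fin (2 ℕ.+ n) → Carrier
    P l = a zero * (sign l * (b (suc l) * F l))
    X l = - (sign l * (a (suc l) * (b zero * F l)))
    Y j = sign j * (a (suc j) * sumFin (suc n) (λ l → sign l * G j l))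
    Z j = - sign j * (a (suc j) * (1# * (b zero * F j)
            + sumFin (suc n) (λ l → - sign l * (b (suc (punchIn j l)) * D (punchIn (suc j) ∘ punchIn (suc l))))))
    lift-punchIn : ∀ j l k → punchIn (suc j) (punchIn (suc l) k) ≡ lift 1 (punchIn j ∘ punchIn l) k
    lift-punchIn j l zero = ≡.refl
    lift-punchIn j l (suc k) = ≡.refl
    inner : ∀ j → sumFin (suc n) (λ l → - sign l * (b (suc (punchIn j l)) * D (punchIn (suc j) ∘ punchIn (suc l))))
                  ≈ - sumFin (suc n) (λ l → sign l * G j l)
    inner j = begin
      sumFin (suc n) (λ l → - sign l * (b (suc (punchIn j l)) * D (punchIn (suc j) ∘ punchIn (suc l))))
        ≈⟨ sumFin-cong (suc n) (λ l → trans (*-congˡ {(- sign l)} (*-congˡ {b (suc (punchIn j l))} (D-resp (lift-punchIn j l))))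
                                            (sym (-‿distribˡ-* _ _))) ⟩
      sumFin (suc n) (λ l → - (sign l * G j l))
        ≈⟨ -‿distrib-sumFin (suc n) (λ l → sign l * G j l) ⟨
      - sumFin (suc n) (λ l → sign l * G j l) ∎
    Z≈X+Y : ∀ j → Z j ≈ X j + Y j
    Z≈X+Y j = begin
      Z j ≈⟨ *-congˡ (*-congˡ (+-congˡ (inner j))) ⟩
      - sign j * (a (suc j) * (1# * (b zero * F j) + - sumFin (suc n) (λ l → sign l * G j l)))
        ≈⟨ solve 5 (λ s x y f t → (:- s) :* (x :* (con (+ 1) :* (y :* f) :+ :- t)) := :- (s :* (x :* (y :* f))) :+ s :* (x :* t))
                   refl (sign j) (a (suc j)) (b zero) (F j) _ ⟩
      X j + Y j ∎

  -- When a ≈ b the terms with j = 0 or l = 0 cancel in pairs (cross), and the rest is the expansion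
  -- of the same rows with the first column deleted.
  pairExpansion-≋ : ∀ n a b D → Respects≗ D → (∀ k → a k ≈ b k) → pairExpansion n a b D ≈ 0#
  pairExpansion-≋ zero a b D D-resp a≈b = begin
    pairExpansion 0 a b D
      ≈⟨ +-cong (*-congˡ (*-congʳ (a≈b zero)))
                (+-congʳ (*-congˡ (*-cong (a≈b (suc zero)) (+-congʳ (*-congˡ (*-congˡ (D-resp λ ()))))))) ⟩
    1# * (b zero * (1# * (b (suc zero) * d) + 0#)) + (- 1# * (b (suc zero) * (1# * (b zero * d) + 0#)) + 0#)
      ≈⟨ solve 3 (λ x y d → con (+ 1) :* (x :* (con (+ 1) :* (y :* d) :+ con (+ 0)))
                              :+ (:- con (+ 1) :* (y :* (con (+ 1) :* (x :* d) :+ con (+ 0))) :+ con (+ 0)) := con (+ 0))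
                 refl (b zero) (b (suc zero)) d ⟩
    0# ∎
    where d = D (punchIn zero ∘ punchIn zero)
  pairExpansion-≋ (suc n) a b D D-resp a≈b = begin
    pairExpansion (suc n) a b D
      ≈⟨ pairExpansion-split n a b D D-resp ⟩
    sumFin (2 ℕ.+ n) cross + pairExpansion n (a ∘ suc) (b ∘ suc) (D ∘ lift 1)
      ≈⟨ +-cong (sumFin-zero (2 ℕ.+ n) cross≈0) (pairExpansion-≋ n (a ∘ suc) (b ∘ suc) (D ∘ lift 1) lift-resp (a≈b ∘ suc)) ⟩
    0# + 0#
      ≈⟨ +-identityʳ 0# ⟩
    0# ∎
    where
    cross : Fin (2 ℕ.+ n) → Carrier
    cross l = a zero * (sign l * (b (suc l) * D (suc ∘ punchIn l))) - sign l * (a (suc l) * (b zero * D (suc ∘ punchIn l)))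
    cross≈0 : ∀ l → cross l ≈ 0#
    cross≈0 l = begin
      cross l
        ≈⟨ +-cong (*-congʳ (a≈b zero)) (-‿cong (*-congˡ (*-congʳ (a≈b (suc l))))) ⟩
      b zero * (sign l * (b (suc l) * f)) - sign l * (b (suc l) * (b zero * f))
        ≈⟨ solve 4 (λ x s y f → x :* (s :* (y :* f)) :- s :* (y :* (x :* f)) := con (+ 0)) refl (b zero) (sign l) (b (suc l)) f ⟩
      0# ∎
      where f = D (suc ∘ punchIn l)
    lift-resp : Respects≗ (D ∘ lift 1)
    lift-resp σ≗τ = D-resp λ { zero → ≡.refl ; (suc k) → ≡.cong suc (σ≗τ k) }

  det-rows₀₁-≋ : ∀ n (M : Matrix (2 ℕ.+ n)) → (∀ k → M zero k ≈ M (suc zero) k) → det (2 ℕ.+ n) M ≈ 0#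
  det-rows₀₁-≋ n M M₀≈M₁ = pairExpansion-≋ n (M zero) (M (suc zero)) _
    (λ σ≗τ → det-cong n λ r k → reflexive (≡.cong (M (suc (suc r))) (σ≗τ k))) M₀≈M₁

  Alternating : ℕ → Set (c ⊔ ℓ)
  Alternating n = ∀ (M : Matrix (suc n)) k → (∀ j → M zero j ≈ M (suc k) j) → det (suc n) M ≈ 0#

  swapRows : ∀ {n} → Matrix n → Fin n → Fin n → Matrix n
  swapRows M i j = M [ i ]≔ M j [ j ]≔ M i

  det-swapRows₀ : ∀ n → Alternating n → ∀ (M : Matrix (suc n)) k →
    det (suc n) (swapRows M zero (suc k)) ≈ - det (suc n) M
  -- Expand the determinant with rows 0 and k + 1 both replaced by a + b.
  det-swapRows₀ n alt M k = inverseʳ-unique _ _ (begin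
    det (suc n) M + det (suc n) (swapRows M zero (suc k))
      ≈⟨ +-cong (+-identityˡ _) (+-identityʳ _) ⟨
    (0# + det (suc n) M) + (det (suc n) (swapRows M zero (suc k)) + 0#)
      ≈⟨ +-cong (+-cong (sym (alt (M [ zero ]≔ a [ suc k ]≔ a) k (hit (M [ zero ]≔ a) a))) (sym (det-cong (suc n) restore)))
                (+-congˡ (sym (alt (M [ zero ]≔ b [ suc k ]≔ b) k (hit (M [ zero ]≔ b) b)))) ⟩
    (det (suc n) (M [ zero ]≔ a [ suc k ]≔ a) + det (suc n) (M [ zero ]≔ a [ suc k ]≔ b))
      + (det (suc n) (M [ zero ]≔ b [ suc k ]≔ a) + det (suc n) (M [ zero ]≔ b [ suc k ]≔ b))
      ≈⟨ +-cong (det-+-row (suc n) (M [ zero ]≔ a) (suc k) a b) (det-+-row (suc n) (M [ zero ]≔ b) (suc k) a b) ⟨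
    det (suc n) (M [ zero ]≔ a [ suc k ]≔ a+b) + det (suc n) (M [ zero ]≔ b [ suc k ]≔ a+b)
      ≈⟨ det-+-row (suc n) (M [ suc k ]≔ a+b) zero a b ⟨
    det (suc n) (M [ suc k ]≔ a+b [ zero ]≔ a+b)
      ≈⟨ alt (M [ suc k ]≔ a+b [ zero ]≔ a+b) k (hit M a+b) ⟩
    0# ∎)
    where
    a b a+b : Row (suc n)
    a = M zero
    b = M (suc k)
    a+b c = a c + b c
    hit : ∀ (N : Matrix (suc n)) w c → w c ≈ (N [ suc k ]≔ w) (suc k) c
    hit N w c = reflexive (≡.cong (λ row → row c) (≡.sym (updateAt-updates (suc k) N)))
    restore : ∀ r c → (M [ zero ]≔ a [ suc k ]≔ b) r c ≈ M r c
    restore zero c = refl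
    restore (suc r) c = reflexive (≡.cong (λ row → row c) (updateAt-id-local k (M ∘ suc) ≡.refl r))

  minor-swapRows₁ : ∀ {n} (M : Matrix (3 ℕ.+ n)) k j r c →
    minor (swapRows M (suc zero) (suc (suc k))) j r c ≡ swapRows (minor M j) zero (suc k) r c
  minor-swapRows₁ M k j zero c = ≡.refl
  minor-swapRows₁ M k j (suc r) c = ≔-columns (λ r → M (suc (suc r))) k (M (suc zero)) (punchIn j) r c

  det-swapRows₁ : ∀ n → Alternating (suc n) → ∀ (M : Matrix (3 ℕ.+ n)) k →
    det (3 ℕ.+ n) (swapRows M (suc zero) (suc (suc k))) ≈ - det (3 ℕ.+ n) M
  det-swapRows₁ n alt M k = begin
    det (3 ℕ.+ n) (swapRows M (suc zero) (suc (suc k)))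
      ≈⟨ sumFin-cong (3 ℕ.+ n) (λ j → *-congˡ {sign j} (*-congˡ {M zero j} (begin
           det (2 ℕ.+ n) (minor (swapRows M (suc zero) (suc (suc k))) j)
             ≈⟨ det-cong (2 ℕ.+ n) (λ r c → reflexive (minor-swapRows₁ M k j r c)) ⟩
           det (2 ℕ.+ n) (swapRows (minor M j) zero (suc k))
             ≈⟨ det-swapRows₀ (suc n) alt (minor M j) k ⟩
           - det (2 ℕ.+ n) (minor M j) ∎))) ⟩
    sumFin (3 ℕ.+ n) (λ j → sign j * (M zero j * - det (2 ℕ.+ n) (minor M j)))
      ≈⟨ sumFin-cong (3 ℕ.+ n) (λ j → solve 3 (λ s m d → s :* (m :* (:- d)) := :- (s :* (m :* d)))
                                              refl (sign j) (M zero j) (det (2 ℕ.+ n) (minor M j))) ⟩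
    sumFin (3 ℕ.+ n) (λ j → - (sign j * (M zero j * det (2 ℕ.+ n) (minor M j))))
      ≈⟨ -‿distrib-sumFin (3 ℕ.+ n) (λ j → sign j * (M zero j * det (2 ℕ.+ n) (minor M j))) ⟨
    - det (3 ℕ.+ n) M ∎

  -- For rows 0 and k + 2, swapping rows 1 and k + 2 negates every minor along row 0 and makes rows 0 and 1 equal.
  det-alternating : ∀ n → Alternating n
  det-alternating (suc n) M zero M₀≈M₁ = det-rows₀₁-≋ n M M₀≈M₁
  det-alternating (suc (suc n)) M (suc k) M₀≈Mₖ = begin
    det (3 ℕ.+ n) M                        ≈⟨ -‿involutive _ ⟨
    - - det (3 ℕ.+ n) M                    ≈⟨ -‿cong (det-swapRows₁ n (det-alternating (suc n)) M k) ⟨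
    - det (3 ℕ.+ n) (swapRows M (suc zero) (suc (suc k)))
                                           ≈⟨ -‿cong (det-rows₀₁-≋ (suc n) (swapRows M (suc zero) (suc (suc k))) M₀≈Mₖ) ⟩
    - 0#                                   ≈⟨ -0#≈0# ⟩
    0#                                     ∎

  sumFin-det-≔ : ∀ n (M : Matrix (suc n)) (c : Row n) w →
    sumFin n (λ r → c r * det (suc n) (M [ suc r ]≔ w))
      ≈ sumFin (suc n) (λ j → sign j * (M zero j * sumFin n (λ r → c r * det n (minor M j [ r ]≔ w ∘ punchIn j))))
  sumFin-det-≔ n M c w = begin
    sumFin n (λ r → c r * det (suc n) (M [ suc r ]≔ w))
      ≈⟨ sumFin-cong n expand ⟩
    sumFin n (λ r → sumFin (suc n) (λ j → sign j * (M zero j * (c r * E j r))))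
      ≈⟨ sumFin-comm n (suc n) (λ r j → sign j * (M zero j * (c r * E j r))) ⟩
    sumFin (suc n) (λ j → sumFin n (λ r → sign j * (M zero j * (c r * E j r))))
      ≈⟨ sumFin-cong (suc n) (λ j → trans (sym (*-distribˡ-sumFin n (sign j) (λ r → M zero j * (c r * E j r))))
                                              (*-congˡ (sym (*-distribˡ-sumFin n (M zero j) (λ r → c r * E j r))))) ⟩
    sumFin (suc n) (λ j → sign j * (M zero j * sumFin n (λ r → c r * E j r))) ∎
    where
    E : Fin (suc n) → Fin n → Carrier
    E j r = det n (minor M j [ r ]≔ w ∘ punchIn j)
    expand : ∀ r → c r * det (suc n) (M [ suc r ]≔ w) ≈ sumFin (suc n) (λ j → sign j * (M zero j * (c r * E j r)))
    expand r = begin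
      c r * sumFin (suc n) (λ j → sign j * (M zero j * det n (minor (M [ suc r ]≔ w) j)))
        ≈⟨ *-distribˡ-sumFin (suc n) (c r) (λ j → sign j * (M zero j * det n (minor (M [ suc r ]≔ w) j))) ⟩
      sumFin (suc n) (λ j → c r * (sign j * (M zero j * det n (minor (M [ suc r ]≔ w) j))))
        ≈⟨ sumFin-cong (suc n) (λ j → *-congˡ {c r} (*-congˡ {sign j} (*-congˡ {M zero j} (det-minor-≔ n M r w j)))) ⟩
      sumFin (suc n) (λ j → c r * (sign j * (M zero j * E j r)))
        ≈⟨ sumFin-cong (suc n) (λ j → solve 4 (λ x s m e → x :* (s :* (m :* e)) := s :* (m :* (x :* e)))
                                                refl (c r) (sign j) (M zero j) (E j r)) ⟩
      sumFin (suc n) (λ j → sign j * (M zero j * (c r * E j r))) ∎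

  det-rank-one-update : ∀ n (M : Matrix n) (c w : Row n) →
    det n (λ r k → M r k + c r * w k) ≈ det n M + sumFin n (λ r → c r * det n (M [ r ]≔ w))
  det-rank-one-update zero M c w = sym (+-identityʳ 1#)
  det-rank-one-update (suc n) M c w = begin
    det (suc n) (λ r k → M r k + c r * w k)
      ≈⟨ sumFin-cong (suc n) (λ j → *-congˡ {sign j} (*-congˡ {M zero j + c zero * w j}
           (det-rank-one-update n (minor M j) (c ∘ suc) (w ∘ punchIn j)))) ⟩
    sumFin (suc n) (λ j → sign j * ((M zero j + c zero * w j) * (D j + S j)))
      ≈⟨ sumFin-cong (suc n) (λ j → solve 6 (λ s m x y d t → s :* ((m :+ x :* y) :* (d :+ t))
                                                 := (s :* (m :* d) :+ x :* (s :* (y :* d))) :+ (s :* (m :* t) :+ x :* (s :* (y :* t))))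
                                       refl (sign j) (M zero j) (c zero) (w j) (D j) (S j)) ⟩
    sumFin (suc n) (λ j → (expand M D j + c zero * expand (M [ zero ]≔ w) D j)
                          + (expand M S j + c zero * expand (M [ zero ]≔ w) S j))
      ≈⟨ trans (sumFin-+ (suc n) (λ j → expand M D j + c zero * expand (M [ zero ]≔ w) D j)
                                         (λ j → expand M S j + c zero * expand (M [ zero ]≔ w) S j))
               (+-cong (sumFin-+-* (suc n) (expand M D) (expand (M [ zero ]≔ w) D) (c zero))
                       (sumFin-+-* (suc n) (expand M S) (expand (M [ zero ]≔ w) S) (c zero))) ⟩
    (det (suc n) M + c zero * det (suc n) (M [ zero ]≔ w))
      + (sumFin (suc n) (λ j → sign j * (M zero j * S j)) + c zero * sumFin (suc n) (λ j → sign j * (w j * S j)))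
      ≈⟨ +-congˡ (+-cong (sym (sumFin-det-≔ n M (c ∘ suc) w))
                         (*-congˡ (trans (sym (sumFin-det-≔ n (M [ zero ]≔ w) (c ∘ suc) w)) (sumFin-zero n repeated-w)))) ⟩
    (det (suc n) M + c zero * det (suc n) (M [ zero ]≔ w))
      + (sumFin n (λ r → c (suc r) * det (suc n) (M [ suc r ]≔ w)) + c zero * 0#)
      ≈⟨ solve 4 (λ a b s x → (a :+ b) :+ (s :+ x :* con (+ 0)) := a :+ (b :+ s)) refl _ _ _ (c zero) ⟩
    det (suc n) M + sumFin (suc n) (λ r → c r * det (suc n) (M [ r ]≔ w)) ∎
    where
    expand : Matrix (suc n) → (Fin (suc n) → Carrier) → Fin (suc n) → Carrier
    expand N X j = sign j * (N zero j * X j)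
    D S : Fin (suc n) → Carrier
    D j = det n (minor M j)
    S j = sumFin n (λ r → c (suc r) * det n (minor M j [ r ]≔ w ∘ punchIn j))
    repeated-w : ∀ r → c (suc r) * det (suc n) (M [ zero ]≔ w [ suc r ]≔ w) ≈ 0#
    repeated-w r = trans (*-congˡ (det-alternating n (M [ zero ]≔ w [ suc r ]≔ w) r
                            (λ k → reflexive (≡.cong (λ row → row k) (≡.sym (updateAt-updates (suc r) (M [ zero ]≔ w)))))))
                         (zeroʳ _)

  infix 7 _·_
  _·_ : ∀ {n} → Row n → Row n → Carrier
  _·_ {n} a b = sumFin n (λ i → a i * b i)

  -- The Kronecker delta δ of Defs goes through _≟_ and does not compute under suc; δ′ does.
  δ′ : ∀ {n} → Fin n → Fin n → Carrier
  δ′ zero zero = 1#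
  δ′ zero (suc k) = 0#
  δ′ (suc r) zero = 0#
  δ′ (suc r) (suc k) = δ′ r k

  δ′-diagonal : ∀ {n} (i : Fin n) → δ′ i i ≡ 1#
  δ′-diagonal zero = ≡.refl
  δ′-diagonal (suc i) = δ′-diagonal i

  δ′-off-diagonal : ∀ {n} {i j : Fin n} → j ≢ i → δ′ i j ≡ 0#
  δ′-off-diagonal {i = zero} {zero} j≢i = ⊥-elim (j≢i ≡.refl)
  δ′-off-diagonal {i = zero} {suc j} j≢i = ≡.refl
  δ′-off-diagonal {i = suc i} {zero} j≢i = ≡.refl
  δ′-off-diagonal {i = suc i} {suc j} j≢i = δ′-off-diagonal (j≢i ∘ ≡.cong suc)

  δ≈δ′ : ∀ {n} (j k : Fin n) → δ j k ≈ δ′ j k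
  δ≈δ′ j k with j Fin.≟ k
  ... | yes ≡.refl = reflexive (≡.sym (δ′-diagonal j))
  ... | no j≢k = reflexive (≡.sym (δ′-off-diagonal (j≢k ∘ ≡.sym)))

  sign² : ∀ {n} (j : Fin n) → sign j * sign j ≈ 1#
  sign² zero = *-identityˡ 1#
  sign² (suc j) = trans (solve 1 (λ s → (:- s) :* (:- s) := s :* s) refl (sign j)) (sign² j)

  module ScaledIdentity (x : Carrier) where

    xI : ∀ {n} → Matrix n
    xI r k = x * δ′ r k

    xI-punchIn : ∀ {n} (i : Fin (suc n)) k → xI i (punchIn i k) ≈ 0#
    xI-punchIn i k = trans (*-congˡ (reflexive (δ′-off-diagonal (punchInᵢ≢i i k)))) (zeroʳ x)

    det-row₀-unit : ∀ n (N : Matrix (suc n)) i → (∀ k → N zero k ≈ x * δ′ i k) →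
      det (suc n) N ≈ sign i * (x * det n (minor N i))
    det-row₀-unit n N i N₀≈xeᵢ = begin
      det (suc n) N
        ≈⟨ sumFin-single (suc n) _ i (λ j j≢i → trans (*-congˡ {sign j} (trans (*-congʳ (trans (N₀≈xeᵢ j) (xI-off j≢i)))
                                                                             (zeroˡ (det n (minor N j)))))
                                                      (zeroʳ _)) ⟩
      sign i * (N zero i * det n (minor N i))
        ≈⟨ *-congˡ (*-congʳ (trans (N₀≈xeᵢ i) (trans (*-congˡ (reflexive (δ′-diagonal i))) (*-identityʳ x)))) ⟩
      sign i * (x * det n (minor N i)) ∎
      where
      xI-off : ∀ {j} → j ≢ i → x * δ′ i j ≈ 0#
      xI-off j≢i = trans (*-congˡ (reflexive (δ′-off-diagonal j≢i))) (zeroʳ x)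

    det-xI : ∀ n → det n xI ≈ x ^ n
    det-xI zero = refl
    det-xI (suc n) = begin
      det (suc n) xI             ≈⟨ det-row₀-unit n xI zero (λ k → refl) ⟩
      1# * (x * det n xI)        ≈⟨ *-identityˡ _ ⟩
      x * det n xI               ≈⟨ *-congˡ (det-xI n) ⟩
      x ^ suc n                  ∎

    det-xI-≔ : ∀ m r (w : Row (suc m)) → det (suc m) (xI [ r ]≔ w) ≈ x ^ m * w r
    det-xI-≔ m zero w = begin
      det (suc m) (xI [ zero ]≔ w)
        ≈⟨ +-congˡ (sumFin-zero m (λ j → trans (*-congˡ {sign (suc j)} (trans (*-congˡ {w (suc j)}
             (det-zero-row m (minor xI (suc j)) j (xI-punchIn (suc j)))) (zeroʳ _))) (zeroʳ _))) ⟩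
      1# * (w zero * det m xI) + 0#
        ≈⟨ trans (+-identityʳ _) (trans (*-identityˡ _) (trans (*-congˡ (det-xI m)) (*-comm _ _))) ⟩
      x ^ m * w zero ∎
    det-xI-≔ (suc m) (suc r) w = begin
      det (2 ℕ.+ m) (xI [ suc r ]≔ w)
        ≈⟨ det-row₀-unit (suc m) (xI [ suc r ]≔ w) zero (λ k → refl) ⟩
      1# * (x * det (suc m) (minor (xI [ suc r ]≔ w) zero))
        ≈⟨ trans (*-identityˡ _) (*-congˡ (trans (det-minor-≔ (suc m) xI r w zero) (det-xI-≔ m r (w ∘ suc)))) ⟩
      x * (x ^ m * w (suc r))
        ≈⟨ *-assoc _ _ _ ⟨
      x ^ suc m * w (suc r) ∎

    det-minor-xI-≔ : ∀ m j (v : Row (suc m)) → det (suc m) (minor xI (suc j) [ j ]≔ v) ≈ sign j * (x ^ m * v zero)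
    det-minor-xI-≔ m zero v = begin
      det (suc m) (minor xI (suc zero) [ zero ]≔ v) ≈⟨ det-cong (suc m) shifted ⟩
      det (suc m) (xI [ zero ]≔ v)                  ≈⟨ det-xI-≔ m zero v ⟩
      x ^ m * v zero                                ≈⟨ *-identityˡ _ ⟨
      1# * (x ^ m * v zero)                         ∎
      where
      shifted : ∀ r c → (minor xI (suc zero) [ zero ]≔ v) r c ≈ (xI [ zero ]≔ v) r c
      shifted zero c = refl
      shifted (suc r) zero = refl
      shifted (suc r) (suc c) = refl
    det-minor-xI-≔ (suc m) (suc j) v = begin
      det (2 ℕ.+ m) (minor xI (2+ j) [ suc j ]≔ v)
        ≈⟨ det-row₀-unit (suc m) (minor xI (2+ j) [ suc j ]≔ v) (suc zero) row₀ ⟩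
      - 1# * (x * det (suc m) (minor (minor xI (2+ j) [ suc j ]≔ v) (suc zero)))
        ≈⟨ *-congˡ (*-congˡ (trans (det-minor-≔ (suc m) (minor xI (2+ j)) j v (suc zero))
                                   (det-cong (suc m) (≔-cong j (v ∘ punchIn (suc zero)) minor₁)))) ⟩
      - 1# * (x * det (suc m) (minor xI (suc j) [ j ]≔ v ∘ punchIn (suc zero)))
        ≈⟨ *-congˡ (*-congˡ (det-minor-xI-≔ m j (v ∘ punchIn (suc zero)))) ⟩
      - 1# * (x * (sign j * (x ^ m * v zero)))
        ≈⟨ solve 4 (λ x s y v → (:- con (+ 1)) :* (x :* (s :* (y :* v))) := (:- s) :* ((x :* y) :* v)) refl x (sign j) (x ^ m) (v zero) ⟩
      - sign j * (x ^ suc m * v zero) ∎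
      where
      2+_ : Fin (suc m) → Fin (3 ℕ.+ m)
      2+ j = suc (suc j)
      row₀ : ∀ c → minor xI (2+ j) zero c ≈ x * δ′ (suc zero) c
      row₀ zero = refl
      row₀ (suc zero) = refl
      row₀ (suc (suc c)) = refl
      minor₁ : ∀ r c → minor (minor xI (2+ j)) (suc zero) r c ≈ minor xI (suc j) r c
      minor₁ r zero = refl
      minor₁ r (suc c) = refl

    det-xI-≔₀-≔ : ∀ m s (w z : Row (2 ℕ.+ m)) →
      det (2 ℕ.+ m) (xI [ zero ]≔ w [ suc s ]≔ z) ≈ x ^ m * (w zero * z (suc s) - w (suc s) * z zero)
    det-xI-≔₀-≔ m s w z = begin
      det (2 ℕ.+ m) (xI [ zero ]≔ w [ suc s ]≔ z)
        ≈⟨ sumFin-cong (2 ℕ.+ m) (λ j → *-congˡ {sign j} (*-congˡ {w j} (det-minor-≔ (suc m) (xI [ zero ]≔ w) s z j))) ⟩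
      1# * (w zero * det (suc m) (xI [ s ]≔ z ∘ suc)) + sumFin (suc m) term
        ≈⟨ +-cong (*-congˡ (*-congˡ (det-xI-≔ m s (z ∘ suc)))) (sumFin-single (suc m) term s others) ⟩
      1# * (w zero * (x ^ m * z (suc s))) + - sign s * (w (suc s) * det (suc m) (minor xI (suc s) [ s ]≔ z ∘ punchIn (suc s)))
        ≈⟨ +-congˡ (*-congˡ (*-congˡ (det-minor-xI-≔ m s (z ∘ punchIn (suc s))))) ⟩
      1# * (w zero * (x ^ m * z (suc s))) + - sign s * (w (suc s) * (sign s * (x ^ m * z zero)))
        ≈⟨ solve 6 (λ a y b s c d → con (+ 1) :* (a :* (y :* b)) :+ (:- s) :* (c :* (s :* (y :* d)))
                                     := y :* (a :* b :- (s :* s) :* (c :* d))) refl (w zero) (x ^ m) (z (suc s)) (sign s) (w (suc s)) (z zero) ⟩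
      x ^ m * (w zero * z (suc s) - (sign s * sign s) * (w (suc s) * z zero))
        ≈⟨ *-congˡ (+-congˡ (-‿cong (trans (*-congʳ (sign² s)) (*-identityˡ _)))) ⟩
      x ^ m * (w zero * z (suc s) - w (suc s) * z zero) ∎
      where
      term : Fin (suc m) → Carrier
      term j = - sign j * (w (suc j) * det (suc m) (minor xI (suc j) [ s ]≔ z ∘ punchIn (suc j)))
      others : ∀ j → j ≢ s → term j ≈ 0#
      others j j≢s = trans (*-congˡ (trans (*-congˡ (det-zero-row (suc m) (minor xI (suc j) [ s ]≔ z ∘ punchIn (suc j)) j λ k →
          trans (reflexive (≡.cong (λ row → row k) (updateAt-minimal j s (minor xI (suc j)) j≢s))) (xI-punchIn (suc j) k)))
        (zeroʳ _))) (zeroʳ _)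

    det-xI-≔-≔ : ∀ m r s (w z : Row (2 ℕ.+ m)) → r ≢ s →
      det (2 ℕ.+ m) (xI [ r ]≔ w [ s ]≔ z) ≈ x ^ m * (w r * z s - w s * z r)
    det-xI-≔-≔ m zero zero w z r≢s = ⊥-elim (r≢s ≡.refl)
    det-xI-≔-≔ m zero (suc s) w z r≢s = det-xI-≔₀-≔ m s w z
    det-xI-≔-≔ m (suc r) zero w z r≢s = begin
      det (2 ℕ.+ m) (xI [ suc r ]≔ w [ zero ]≔ z)
        ≈⟨ det-cong (2 ℕ.+ m) commute ⟩
      det (2 ℕ.+ m) (xI [ zero ]≔ z [ suc r ]≔ w)
        ≈⟨ det-xI-≔₀-≔ m r z w ⟩
      x ^ m * (z zero * w (suc r) - z (suc r) * w zero)
        ≈⟨ solve 5 (λ y a b c d → y :* (a :* b :- c :* d) := y :* (b :* a :- d :* c)) refl (x ^ m) (z zero) (w (suc r)) (z (suc r)) (w zero) ⟩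
      x ^ m * (w (suc r) * z zero - w zero * z (suc r)) ∎
      where
      commute : ∀ a b → (xI [ suc r ]≔ w [ zero ]≔ z) a b ≈ (xI [ zero ]≔ z [ suc r ]≔ w) a b
      commute zero b = refl
      commute (suc a) b = refl
    det-xI-≔-≔ zero (suc zero) (suc zero) w z r≢s = ⊥-elim (r≢s ≡.refl)
    det-xI-≔-≔ (suc m) (suc r) (suc s) w z r≢s = begin
      det (3 ℕ.+ m) (xI [ suc r ]≔ w [ suc s ]≔ z)
        ≈⟨ det-row₀-unit (2 ℕ.+ m) (xI [ suc r ]≔ w [ suc s ]≔ z) zero (λ k → refl) ⟩
      1# * (x * det (2 ℕ.+ m) (minor (xI [ suc r ]≔ w [ suc s ]≔ z) zero))
        ≈⟨ *-congˡ (*-congˡ (trans (det-minor-≔ (2 ℕ.+ m) (xI [ suc r ]≔ w) s z zero)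
             (det-cong (2 ℕ.+ m) (≔-cong s (z ∘ suc) (λ a b → reflexive (≔-columns (xI ∘ suc) r w suc a b)))))) ⟩
      1# * (x * det (2 ℕ.+ m) (xI [ r ]≔ w ∘ suc [ s ]≔ z ∘ suc))
        ≈⟨ *-congˡ (*-congˡ (det-xI-≔-≔ m r s (w ∘ suc) (z ∘ suc) (r≢s ∘ ≡.cong suc))) ⟩
      1# * (x * (x ^ m * (w (suc r) * z (suc s) - w (suc s) * z (suc r))))
        ≈⟨ trans (*-identityˡ _) (sym (*-assoc _ _ _)) ⟩
      x ^ suc m * (w (suc r) * z (suc s) - w (suc s) * z (suc r)) ∎

    det-xI+rank₁ : ∀ m (a b : Row (suc m)) → det (suc m) (λ r k → x * δ′ r k + a r * b k) ≈ x ^ suc m + x ^ m * (a · b)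
    det-xI+rank₁ m a b = begin
      det (suc m) (λ r k → xI r k + a r * b k)
        ≈⟨ det-rank-one-update (suc m) xI a b ⟩
      det (suc m) xI + sumFin (suc m) (λ r → a r * det (suc m) (xI [ r ]≔ b))
        ≈⟨ +-cong (det-xI (suc m)) (sumFin-cong (suc m) (λ r → *-congˡ {a r} (det-xI-≔ m r b))) ⟩
      x ^ suc m + sumFin (suc m) (λ r → a r * (x ^ m * b r))
        ≈⟨ +-congˡ (sumFin-cong (suc m) (λ r → x∙yz≈y∙xz (a r) (x ^ m) (b r))) ⟩
      x ^ suc m + sumFin (suc m) (λ r → x ^ m * (a r * b r))
        ≈⟨ +-congˡ (*-distribˡ-sumFin (suc m) (x ^ m) (λ r → a r * b r)) ⟨
      x ^ suc m + x ^ m * (a · b) ∎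

    det-xI+rank₁-≔ : ∀ m (a b d : Row (2 ℕ.+ m)) r →
      det (2 ℕ.+ m) ((λ s k → x * δ′ s k + a s * b k) [ r ]≔ d) ≈ x ^ suc m * d r + x ^ m * ((a · b) * d r - (a · d) * b r)
    det-xI+rank₁-≔ m a b d r = begin
      det n ((λ s k → xI s k + a s * b k) [ r ]≔ d)
        ≈⟨ det-cong n (≔-rank-one xI a b d r) ⟩
      det n (λ s k → (xI [ r ]≔ d) s k + a′ s * b k)
        ≈⟨ det-rank-one-update n (xI [ r ]≔ d) a′ b ⟩
      det n (xI [ r ]≔ d) + sumFin n (λ s → a′ s * det n (xI [ r ]≔ d [ s ]≔ b))
        ≈⟨ +-cong (det-xI-≔ (suc m) r d) (sumFin-cong n term) ⟩
      x ^ suc m * d r + sumFin n (λ s → x ^ m * ((a s * b s) * d r - (a s * d s) * b r))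
        ≈⟨ +-congˡ (sumFin-linear n (x ^ m) (d r) (b r) (λ s → a s * b s) (λ s → a s * d s)) ⟩
      x ^ suc m * d r + x ^ m * ((a · b) * d r - (a · d) * b r) ∎
      where
      n = 2 ℕ.+ m
      a′ : Row n
      a′ = updateAt a r (const 0#)
      term : ∀ s → a′ s * det n (xI [ r ]≔ d [ s ]≔ b) ≈ x ^ m * ((a s * b s) * d r - (a s * d s) * b r)
      term s with r Fin.≟ s
      ... | yes ≡.refl = begin
        a′ r * det n (xI [ r ]≔ d [ r ]≔ b) ≈⟨ *-congʳ (reflexive (updateAt-updates r a)) ⟩
        0# * det n (xI [ r ]≔ d [ r ]≔ b)   ≈⟨ zeroˡ _ ⟩
        0#                                  ≈⟨ solve 4 (λ y a b d → con (+ 0) := y :* ((a :* b) :* d :- (a :* d) :* b)) refl (x ^ m) (a r) (b r) (d r) ⟩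
        x ^ m * ((a r * b r) * d r - (a r * d r) * b r) ∎
      ... | no r≢s = begin
        a′ s * det n (xI [ r ]≔ d [ s ]≔ b)
          ≈⟨ *-cong (reflexive (updateAt-minimal s r a (r≢s ∘ ≡.sym))) (det-xI-≔-≔ m r s d b r≢s) ⟩
        a s * (x ^ m * (d r * b s - d s * b r))
          ≈⟨ solve 6 (λ a y d b D B → a :* (y :* (d :* b :- D :* B)) := y :* ((a :* b) :* d :- (a :* D) :* B))
                     refl (a s) (x ^ m) (d r) (b s) (d s) (b r) ⟩
        x ^ m * ((a s * b s) * d r - (a s * d s) * b r) ∎

    det-xI+rank₂ : ∀ m (a b c d : Row (2 ℕ.+ m)) →
      det (2 ℕ.+ m) (λ r k → x * δ′ r k + a r * b k + c r * d k)
        ≈ x ^ (2 ℕ.+ m) + x ^ suc m * (a · b + c · d) + x ^ m * ((a · b) * (c · d) - (a · d) * (c · b))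
    det-xI+rank₂ m a b c d = begin
      det n (λ r k → N r k + c r * d k)
        ≈⟨ det-rank-one-update n N c d ⟩
      det n N + sumFin n (λ r → c r * det n (N [ r ]≔ d))
        ≈⟨ +-cong (det-xI+rank₁ (suc m) a b) (sumFin-cong n (λ r → *-congˡ {c r} (det-xI+rank₁-≔ m a b d r))) ⟩
      (x ^ n + x ^ suc m * (a · b)) + sumFin n (λ r → c r * (x ^ suc m * d r + x ^ m * ((a · b) * d r - (a · d) * b r)))
        ≈⟨ +-congˡ (sumFin-cong n (λ r → solve 7 (λ c y d z ab ad b → c :* (y :* d :+ z :* (ab :* d :- ad :* b))
                                                        := y :* (c :* d) :+ z :* ((c :* d) :* ab :- (c :* b) :* ad))
                                           refl (c r) (x ^ suc m) (d r) (x ^ m) (a · b) (a · d) (b r))) ⟩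
      (x ^ n + x ^ suc m * (a · b)) + sumFin n (λ r → x ^ suc m * (c r * d r) + x ^ m * ((c r * d r) * (a · b) - (c r * b r) * (a · d)))
        ≈⟨ +-congˡ (trans (sumFin-+ n (λ r → x ^ suc m * (c r * d r)) (λ r → x ^ m * ((c r * d r) * (a · b) - (c r * b r) * (a · d))))
                   (+-cong (sym (*-distribˡ-sumFin n (x ^ suc m) (λ r → c r * d r)))
                           (sumFin-linear n (x ^ m) (a · b) (a · d) (λ r → c r * d r) (λ r → c r * b r)))) ⟩
      (x ^ n + x ^ suc m * (a · b)) + (x ^ suc m * (c · d) + x ^ m * ((c · d) * (a · b) - (c · b) * (a · d)))
        ≈⟨ solve 7 (λ X Y Z ab cd ad cb → (X :+ Y :* ab) :+ (Y :* cd :+ Z :* (cd :* ab :- cb :* ad))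
                                            := X :+ Y :* (ab :+ cd) :+ Z :* (ab :* cd :- ad :* cb))
                   refl (x ^ n) (x ^ suc m) (x ^ m) (a · b) (c · d) (a · d) (c · b) ⟩
      x ^ n + x ^ suc m * (a · b + c · d) + x ^ m * ((a · b) * (c · d) - (a · d) * (c · b)) ∎
      where
      n = 2 ℕ.+ m
      N : Matrix n
      N r k = x * δ′ r k + a r * b k

    det-xI-rank₂ : ∀ m (a b c d : Row (2 ℕ.+ m)) →
      det (2 ℕ.+ m) (λ r k → x * δ′ r k - (a r * b k + c r * d k))
        ≈ x ^ (2 ℕ.+ m) - x ^ suc m * (a · b + c · d) + x ^ m * ((a · b) * (c · d) - (a · d) * (c · b))
    det-xI-rank₂ m a b c d = begin
      det (2 ℕ.+ m) (λ r k → x * δ′ r k - (a r * b k + c r * d k))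
        ≈⟨ det-cong (2 ℕ.+ m) (λ r k → solve 5 (λ e a b c d → e :- (a :* b :+ c :* d) := e :+ (:- a) :* b :+ (:- c) :* d)
                                                refl (x * δ′ r k) (a r) (b k) (c r) (d k)) ⟩
      det (2 ℕ.+ m) (λ r k → x * δ′ r k + - a r * b k + - c r * d k)
        ≈⟨ det-xI+rank₂ m (-_ ∘ a) b (-_ ∘ c) d ⟩
      x ^ (2 ℕ.+ m) + x ^ suc m * ((-_ ∘ a) · b + (-_ ∘ c) · d)
        + x ^ m * (((-_ ∘ a) · b) * ((-_ ∘ c) · d) - ((-_ ∘ a) · d) * ((-_ ∘ c) · b))
        ≈⟨ +-cong (+-congˡ (*-congˡ (+-cong (neg-· a b) (neg-· c d))))
                  (*-congˡ (+-cong (*-cong (neg-· a b) (neg-· c d)) (-‿cong (*-cong (neg-· a d) (neg-· c b))))) ⟩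
      x ^ (2 ℕ.+ m) + x ^ suc m * (- (a · b) + - (c · d)) + x ^ m * (- (a · b) * - (c · d) - - (a · d) * - (c · b))
        ≈⟨ solve 7 (λ X Y Z ab cd ad cb → X :+ Y :* (:- ab :+ :- cd) :+ Z :* ((:- ab) :* (:- cd) :- (:- ad) :* (:- cb))
                                          := X :- Y :* (ab :+ cd) :+ Z :* (ab :* cd :- ad :* cb))
                   refl (x ^ (2 ℕ.+ m)) (x ^ suc m) (x ^ m) (a · b) (c · d) (a · d) (c · b) ⟩
      x ^ (2 ℕ.+ m) - x ^ suc m * (a · b + c · d) + x ^ m * ((a · b) * (c · d) - (a · d) * (c · b)) ∎
      where
      neg-· : (f g : Row (2 ℕ.+ m)) → (-_ ∘ f) · g ≈ - (f · g)
      neg-· f g = trans (sumFin-cong (2 ℕ.+ m) (λ i → sym (-‿distribˡ-* (f i) (g i))))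
                        (sym (-‿distrib-sumFin (2 ℕ.+ m) (λ i → f i * g i)))

module LucasSequence {c ℓ : Level} (R : CommutativeRing c ℓ) (A : CommutativeRing.Carrier R) where
  open CommutativeRing R hiding (zero)
  open RingDefs R
  open FinSum R
  open ℤ-CoefficientSolver R using (solve; _:=_; _:+_; _:*_; :-_; _:-_; con)
  open import Algebra.Properties.Group +-group using (x≈z//y)
  open import Relation.Binary.Reasoning.Setoid setoid

  U : ℕ → Carrier
  U = u A (- 1#)

  -- U⁻ m = u_{m-1}, continuing the recurrence to u_{-1} = 1.
  U⁻ : ℕ → Carrier
  U⁻ zero = 1#
  U⁻ (suc m) = U m

  U-suc : ∀ m → U (suc m) ≈ A * U m + U⁻ m
  U-suc zero = solve 1 (λ A → con (+ 1) := A :* con (+ 0) :+ con (+ 1)) refl A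
  U-suc (suc m) = solve 3 (λ A p q → A :* p :- (:- con (+ 1)) :* q := A :* p :+ q) refl A (U (suc m)) (U m)

  U-suc-suc : ∀ m → U (suc (suc m)) ≈ A * (A * U m + U⁻ m) + U m
  U-suc-suc m = trans (U-suc (suc m)) (+-congʳ (*-congˡ (U-suc m)))

  U-+ : ∀ i j → U (i ℕ.+ j) ≈ U (suc i) * U j + U i * U⁻ j
  U-+ zero j = solve 2 (λ p q → p := con (+ 1) :* p :+ con (+ 0) :* q) refl (U j) (U⁻ j)
  U-+ (suc zero) j = trans (U-suc j)
    (solve 3 (λ A p q → A :* p :+ q := (A :* con (+ 1) :- (:- con (+ 1)) :* con (+ 0)) :* p :+ con (+ 1) :* q) refl A (U j) (U⁻ j))
  U-+ (suc (suc i)) j = begin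
    U (2 ℕ.+ i ℕ.+ j)
      ≈⟨ U-suc (suc i ℕ.+ j) ⟩
    A * U (suc i ℕ.+ j) + U (i ℕ.+ j)
      ≈⟨ +-cong (*-congˡ (U-+ (suc i) j)) (U-+ i j) ⟩
    A * (U (2 ℕ.+ i) * U j + U (suc i) * U⁻ j) + (U (suc i) * U j + U i * U⁻ j)
      ≈⟨ solve 6 (λ A p q r s t → A :* (p :* s :+ q :* t) :+ (q :* s :+ r :* t) := (A :* p :+ q) :* s :+ (A :* q :+ r) :* t)
                 refl A (U (2 ℕ.+ i)) (U (suc i)) (U i) (U j) (U⁻ j) ⟩
    (A * U (2 ℕ.+ i) + U (suc i)) * U j + (A * U (suc i) + U i) * U⁻ j
      ≈⟨ +-cong (*-congʳ (U-suc (2 ℕ.+ i))) (*-congʳ (U-suc (suc i))) ⟨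
    U (3 ℕ.+ i) * U j + U (2 ℕ.+ i) * U⁻ j ∎

  V : ℕ → Carrier
  V = v A (- 1#)

  V-suc : ∀ m → V (suc (suc m)) ≈ A * V (suc m) + V m
  V-suc m = solve 3 (λ A p q → A :* p :- (:- con (+ 1)) :* q := A :* p :+ q) refl A (V (suc m)) (V m)

  V≈U+U : ∀ m → V (suc m) ≈ U (suc (suc m)) + U m
  V≈U+U zero = solve 1 (λ A → A := (A :* con (+ 1) :- (:- con (+ 1)) :* con (+ 0)) :+ con (+ 0)) refl A
  V≈U+U (suc zero) = solve 1 (λ A → A :* A :- (:- con (+ 1)) :* (con (+ 1) :+ con (+ 1))
                                   := (A :* (A :* con (+ 1) :- (:- con (+ 1)) :* con (+ 0)) :- (:- con (+ 1)) :* con (+ 1)) :+ con (+ 1))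
                          refl A
  V≈U+U (suc (suc m)) = begin
    V (3 ℕ.+ m)
      ≈⟨ V-suc (suc m) ⟩
    A * V (2 ℕ.+ m) + V (suc m)
      ≈⟨ +-cong (*-congˡ (V≈U+U (suc m))) (V≈U+U m) ⟩
    A * (U (3 ℕ.+ m) + U (suc m)) + (U (2 ℕ.+ m) + U m)
      ≈⟨ solve 5 (λ A a b c d → A :* (a :+ b) :+ (c :+ d) := (A :* a :+ c) :+ (A :* b :+ d)) refl A (U (3 ℕ.+ m)) (U (suc m)) (U (2 ℕ.+ m)) (U m) ⟩
    (A * U (3 ℕ.+ m) + U (2 ℕ.+ m)) + (A * U (suc m) + U m)
      ≈⟨ +-cong (U-suc (3 ℕ.+ m)) (U-suc (suc m)) ⟨
    U (4 ℕ.+ m) + U (2 ℕ.+ m) ∎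

  sumUpTo-suc-suc : ∀ n f → sumUpTo (suc (suc n)) f ≈ (sumUpTo n f + f n) + f (suc n)
  sumUpTo-suc-suc n f = trans (sumUpTo-suc (suc n) f) (+-congʳ (sumUpTo-suc n f))

  A*∑U² : ∀ n → A * sumUpTo n (λ j → U j * U j) ≈ U n * U⁻ n
  A*∑U² zero = trans (zeroʳ A) (sym (zeroˡ 1#))
  A*∑U² (suc n) = begin
    A * sumUpTo (suc n) (λ j → U j * U j)            ≈⟨ *-congˡ (sumUpTo-suc n (λ j → U j * U j)) ⟩
    A * (sumUpTo n (λ j → U j * U j) + U n * U n)    ≈⟨ distribˡ _ _ _ ⟩
    A * sumUpTo n (λ j → U j * U j) + A * (U n * U n) ≈⟨ +-congʳ (A*∑U² n) ⟩
    U n * U⁻ n + A * (U n * U n)                     ≈⟨ solve 3 (λ A a w → a :* w :+ A :* (a :* a) := (A :* a :+ w) :* a) refl A (U n) (U⁻ n) ⟩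
    (A * U n + U⁻ n) * U n                           ≈⟨ *-congʳ (U-suc n) ⟨
    U (suc n) * U n                                  ∎

  ∑UU⁻+UU⁻ : ∀ n → sumUpTo n (λ j → U j * U⁻ j) + U n * U⁻ n ≈ sumUpTo n (λ j → U (suc j) * U j)
  ∑UU⁻+UU⁻ zero = trans (+-identityˡ _) (zeroˡ 1#)
  ∑UU⁻+UU⁻ (suc n) = begin
    sumUpTo (suc n) (λ j → U j * U⁻ j) + U (suc n) * U n
      ≈⟨ +-congʳ (sumUpTo-suc n (λ j → U j * U⁻ j)) ⟩
    (sumUpTo n (λ j → U j * U⁻ j) + U n * U⁻ n) + U (suc n) * U n
      ≈⟨ +-congʳ (∑UU⁻+UU⁻ n) ⟩
    sumUpTo n (λ j → U (suc j) * U j) + U (suc n) * U n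
      ≈⟨ sumUpTo-suc n (λ j → U (suc j) * U j) ⟨
    sumUpTo (suc n) (λ j → U (suc j) * U j) ∎

  ∑U₊U⁻-even : ∀ k → sumUpTo (k ℕ.* 2) (λ j → U (suc j) * U⁻ j) ≈ sumUpTo (k ℕ.* 2) (λ j → U j * U j)
  ∑U₊U⁻-even zero = refl
  ∑U₊U⁻-even (suc k) = begin
    sumUpTo (2 ℕ.+ n) (λ j → U (suc j) * U⁻ j)
      ≈⟨ sumUpTo-suc-suc n (λ j → U (suc j) * U⁻ j) ⟩
    (sumUpTo n (λ j → U (suc j) * U⁻ j) + U (suc n) * U⁻ n) + U (2 ℕ.+ n) * U n
      ≈⟨ +-cong (+-congʳ (∑U₊U⁻-even k)) (*-congʳ (U-suc (suc n))) ⟩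
    (sumUpTo n (λ j → U j * U j) + U (suc n) * U⁻ n) + (A * U (suc n) + U n) * U n
      ≈⟨ solve 5 (λ A s a w b → (s :+ b :* w) :+ (A :* b :+ a) :* a := (s :+ a :* a) :+ b :* (A :* a :+ w))
                 refl A (sumUpTo n (λ j → U j * U j)) (U n) (U⁻ n) (U (suc n)) ⟩
    (sumUpTo n (λ j → U j * U j) + U n * U n) + U (suc n) * (A * U n + U⁻ n)
      ≈⟨ +-congˡ (*-congˡ (U-suc n)) ⟨
    (sumUpTo n (λ j → U j * U j) + U n * U n) + U (suc n) * U (suc n)
      ≈⟨ sumUpTo-suc-suc n (λ j → U j * U j) ⟨
    sumUpTo (2 ℕ.+ n) (λ j → U j * U j) ∎
    where n = k ℕ.* 2

  A*∑U₊U-even : ∀ k → A * sumUpTo (k ℕ.* 2) (λ j → U (suc j) * U j) ≈ U (k ℕ.* 2) * U (k ℕ.* 2)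
  A*∑U₊U-even zero = trans (zeroʳ A) (sym (zeroˡ 0#))
  A*∑U₊U-even (suc k) = begin
    A * sumUpTo (2 ℕ.+ n) (λ j → U (suc j) * U j)
      ≈⟨ *-congˡ (sumUpTo-suc-suc n (λ j → U (suc j) * U j)) ⟩
    A * ((sumUpTo n (λ j → U (suc j) * U j) + U (suc n) * U n) + U (2 ℕ.+ n) * U (suc n))
      ≈⟨ solve 5 (λ A s b a c → A :* ((s :+ b :* a) :+ c :* b) := (A :* s :+ (A :* b) :* a) :+ c :* (A :* b))
                 refl A (sumUpTo n (λ j → U (suc j) * U j)) (U (suc n)) (U n) (U (2 ℕ.+ n)) ⟩
    (A * sumUpTo n (λ j → U (suc j) * U j) + (A * U (suc n)) * U n) + U (2 ℕ.+ n) * (A * U (suc n))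
      ≈⟨ +-congʳ (+-congʳ (A*∑U₊U-even k)) ⟩
    (U n * U n + (A * U (suc n)) * U n) + U (2 ℕ.+ n) * (A * U (suc n))
      ≈⟨ +-congʳ (trans (+-comm _ _) (sym (distribʳ _ _ _))) ⟩
    (A * U (suc n) + U n) * U n + U (2 ℕ.+ n) * (A * U (suc n))
      ≈⟨ +-congʳ (*-congʳ (U-suc (suc n))) ⟨
    U (2 ℕ.+ n) * U n + U (2 ℕ.+ n) * (A * U (suc n))
      ≈⟨ trans (sym (distribˡ _ _ _)) (*-congˡ (+-comm _ _)) ⟩
    U (2 ℕ.+ n) * (A * U (suc n) + U n)
      ≈⟨ *-congˡ (U-suc (suc n)) ⟨
    U (2 ℕ.+ n) * U (2 ℕ.+ n) ∎
    where n = k ℕ.* 2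

  cassini-even : ∀ k → let n = k ℕ.* 2 in U n * U n - A * U n * U⁻ n - U⁻ n * U⁻ n ≈ - 1#
  cassini-even zero = solve 1 (λ A → con (+ 0) :* con (+ 0) :- A :* con (+ 0) :* con (+ 1) :- con (+ 1) :* con (+ 1) := :- con (+ 1)) refl A
  cassini-even (suc k) = begin
    form (U (2 ℕ.+ n)) (U (suc n))
      ≈⟨ form-cong (U-suc-suc n) (U-suc n) ⟩
    form (A * (A * U n + U⁻ n) + U n) (A * U n + U⁻ n)
      ≈⟨ solve 3 (λ A a w → let b = A :* a :+ w ; c = A :* b :+ a in c :* c :- A :* c :* b :- b :* b := a :* a :- A :* a :* w :- w :* w)
                 refl A (U n) (U⁻ n) ⟩
    form (U n) (U⁻ n)
      ≈⟨ cassini-even k ⟩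
    - 1# ∎
    where
    n = k ℕ.* 2
    form : Carrier → Carrier → Carrier
    form p q = p * p - A * p * q - q * q
    form-cong : ∀ {p p′ q q′} → p ≈ p′ → q ≈ q′ → form p q ≈ form p′ q′
    form-cong p≈p′ q≈q′ =
      +-cong (+-cong (*-cong p≈p′ p≈p′) (-‿cong (*-cong (*-congˡ p≈p′) q≈q′))) (-‿cong (*-cong q≈q′ q≈q′))

  module HankelSums (n : ℕ) where
    P P′ Q S : Carrier
    P = sumUpTo n (λ j → U (suc j) * U j)
    P′ = sumUpTo n (λ j → U j * U⁻ j)
    Q = sumUpTo n (λ j → U (suc j) * U⁻ j)
    S = sumUpTo n (λ j → U j * U j)

    P′≈P-UU⁻ : P′ ≈ P - U n * U⁻ n
    P′≈P-UU⁻ = x≈z//y _ _ _ (∑UU⁻+UU⁻ n)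

  trace-even : ∀ k → let open HankelSums (suc k ℕ.* 2) in
    A * A * (P + P′) ≈ A * U (suc k ℕ.* 2) * V (suc (k ℕ.* 2))
  trace-even k = begin
    A * A * (P + P′)
      ≈⟨ *-congˡ (+-congˡ P′≈P-UU⁻) ⟩
    A * A * (P + (P - a * w))
      ≈⟨ solve 4 (λ A P a w → A :* A :* (P :+ (P :- a :* w)) := A :* (A :* P :+ A :* P :- A :* (a :* w))) refl A P a w ⟩
    A * (A * P + A * P - A * (a * w))
      ≈⟨ *-congˡ (+-congʳ (+-cong (A*∑U₊U-even (suc k)) (A*∑U₊U-even (suc k)))) ⟩
    A * (a * a + a * a - A * (a * w))
      ≈⟨ solve 3 (λ A a w → A :* (a :* a :+ a :* a :- A :* (a :* w)) := A :* a :* (a :+ (a :- A :* w))) refl A a w ⟩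
    A * a * (a + (a - A * w))
      ≈⟨ *-congˡ (+-congˡ U-backward) ⟨
    A * a * (a + U m)
      ≈⟨ *-congˡ (V≈U+U m) ⟨
    A * a * V (suc m) ∎
    where
    open HankelSums (suc k ℕ.* 2)
    m = k ℕ.* 2
    a = U (2 ℕ.+ m)
    w = U (suc m)
    U-backward : U m ≈ a - A * w
    U-backward = x≈z//y _ _ _ (trans (+-comm _ _) (sym (U-suc (suc m))))

  principal-minors-even : ∀ k → let open HankelSums (suc k ℕ.* 2) in
    A * A * (P * P′ - Q * S) ≈ - (U (suc k ℕ.* 2) * U (suc k ℕ.* 2))
  principal-minors-even k = begin
    A * A * (P * P′ - Q * S)
      ≈⟨ *-congˡ (+-cong (*-congˡ P′≈P-UU⁻) (-‿cong (*-congʳ (∑U₊U⁻-even (suc k))))) ⟩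
    A * A * (P * (P - a * w) - S * S)
      ≈⟨ solve 5 (λ A P S a w → A :* A :* (P :* (P :- a :* w) :- S :* S)
                                 := (A :* P) :* (A :* P) :- (A :* P) :* (A :* (a :* w)) :- (A :* S) :* (A :* S)) refl A P S a w ⟩
    (A * P) * (A * P) - (A * P) * (A * (a * w)) - (A * S) * (A * S)
      ≈⟨ +-cong (+-cong (*-cong AP AP) (-‿cong (*-congʳ AP))) (-‿cong (*-cong (A*∑U² n) (A*∑U² n))) ⟩
    (a * a) * (a * a) - (a * a) * (A * (a * w)) - (a * w) * (a * w)
      ≈⟨ solve 3 (λ A a w → (a :* a) :* (a :* a) :- (a :* a) :* (A :* (a :* w)) :- (a :* w) :* (a :* w)
                             := (a :* a) :* (a :* a :- A :* a :* w :- w :* w)) refl A a w ⟩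
    (a * a) * (a * a - A * a * w - w * w)
      ≈⟨ *-congˡ (cassini-even (suc k)) ⟩
    (a * a) * - 1#
      ≈⟨ solve 1 (λ b → b :* (:- con (+ 1)) := :- b) refl (a * a) ⟩
    - (a * a) ∎
    where
    open HankelSums (suc k ℕ.* 2)
    n = suc k ℕ.* 2
    a = U n
    w = U⁻ n
    AP : A * P ≈ a * a
    AP = A*∑U₊U-even (suc k)

corollary1p12 : ∀ {c ℓ : Level} (R : CommutativeRing c ℓ) →
    let open CommutativeRing R
        open RingDefs R
    in (A : Carrier) → ¬ (A * (A * A + (1# + 1# + 1# + 1#)) ≈ 0#) →
       (n : ℕ) → 0 < n → 2 ∣ n → (x : Carrier) →
       (A * A) * det n (λ j k → x * δ j k - u A (- 1#) (toℕ j ℕ.+ toℕ k))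
         ≈ (A * A) * (x ^ n)
           - A * u A (- 1#) n * v A (- 1#) (n ∸ 1) * (x ^ (n ∸ 1))
           - u A (- 1#) n * u A (- 1#) n * (x ^ (n ∸ 2))
corollary1p12 R A _ .(ℕ.suc k ℕ.* 2) _ (divides (ℕ.suc k) ≡.refl) x = begin
  A * A * det n (λ j k → x * δ j k - U (toℕ j ℕ.+ toℕ k))
    ≈⟨ *-congˡ (det-cong n λ j k → +-cong (*-congˡ {x} (δ≈δ′ j k)) (-‿cong (U-+ (toℕ j) (toℕ k)))) ⟩
  A * A * det n (λ j k → x * δ′ j k - (U (ℕ.suc (toℕ j)) * U (toℕ k) + U (toℕ j) * U⁻ (toℕ k)))
    ≈⟨ *-congˡ (det-xI-rank₂ m (λ j → U (ℕ.suc (toℕ j))) (λ j → U (toℕ j)) (λ j → U (toℕ j)) (λ j → U⁻ (toℕ j))) ⟩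
  A * A * (x ^ n - x ^ ℕ.suc m * (P + P′) + x ^ m * (P * P′ - Q * S))
    ≈⟨ solve 8 (λ A X Y Z P P′ Q S → A :* A :* (X :- Y :* (P :+ P′) :+ Z :* (P :* P′ :- Q :* S))
                                      := A :* A :* X :- (A :* A :* (P :+ P′)) :* Y :+ (A :* A :* (P :* P′ :- Q :* S)) :* Z)
               refl A (x ^ n) (x ^ ℕ.suc m) (x ^ m) P P′ Q S ⟩
  A * A * x ^ n - (A * A * (P + P′)) * x ^ ℕ.suc m + (A * A * (P * P′ - Q * S)) * x ^ m
    ≈⟨ +-cong (+-congˡ (-‿cong (*-congʳ (trace-even k)))) (*-congʳ (principal-minors-even k)) ⟩
  A * A * x ^ n - A * U n * V (ℕ.suc m) * x ^ ℕ.suc m + - (U n * U n) * x ^ m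
    ≈⟨ +-congˡ (sym (-‿distribˡ-* _ _)) ⟩
  A * A * x ^ n - A * U n * V (ℕ.suc m) * x ^ ℕ.suc m - U n * U n * x ^ m ∎
  where
  open CommutativeRing R
  open RingDefs R
  open Determinant R using (det-cong; δ≈δ′; δ′; module ScaledIdentity)
  open ScaledIdentity x using (det-xI-rank₂)
  open LucasSequence R A using (U; U⁻; V; U-+; trace-even; principal-minors-even; module HankelSums)
  open HankelSums (ℕ.suc k ℕ.* 2)
  open ℤ-CoefficientSolver R using (solve; _:=_; _:+_; _:*_; _:-_)
  open import Algebra.Properties.Ring ring using (-‿distribˡ-*)
  open import Relation.Binary.Reasoning.Setoid setoid
  m = k ℕ.* 2
  n = ℕ.suc k ℕ.* 2
corollary1p12 R A _ .(0 ℕ.* 2) () (divides ℕ.zero ≡.refl) x
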